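{- Let $n\ge 1$ and let $\mathcal{F}\subseteq \Omega=\{0,1\}^n$ be decreasing. Then the following three statements are equivalent. (a) There is a $k\in[n]$ such that the maximum of $|\mathcal{B}|$ over all intersecting subfamilies $\mathcal{B}\subseteq\mathcal{F}$ equals $|\{A\in\mathcal{F}: k\in A\}|$. (b) There is a $k\in[n]$ such that the maximum of $\mathrm{Cor}(\mathcal{F},\mathcal{B})$ over all maximal (with respect to inclusion) intersecting families $\mathcal{B}\subseteq\Omega$ is attained by $\mathcal{B}=\{A\in\Omega: k\in A\}$. (c) For every increasing, antipodal $\mathcal{B}\subseteq\Omega$, $\mathrm{Cor}(\mathcal{F},\mathcal{B})\le -\tfrac14 I_{\min}(\mathcal{F})$.
   Context: Subsets of $[n]=\{1,\dots,n\}$ are identified with elements of $\Omega=\{0,1\}^n$ in the natural way, and $\mu$ denotes the uniform probability measure on $\Omega$. A family $\mathcal{G}\subseteq\Omega$ is intersecting if $A\cap B\neq\emptyset$ for all $A,B\in\mathcal{G}$; increasing if $A\supseteq B\in\mathcal{G}$ implies $A\in\mathcal{G}$; decreasing if $A\subseteq B\in\mathcal{G}$ implies $A\in\mathcal{G}$; antipodal if for each $A\subseteq[n]$ exactly one of $A$ and its complement $A^c$ lies in $\mathcal{G}$. For $\mathcal{A},\mathcal{B}\subseteq\Omega$, $\mathrm{Cor}(\mathcal{A},\mathcal{B})=\mu(\mathcal{A}\cap\mathcal{B})-\mu(\mathcal{A})\mu(\mathcal{B})$. The influence of coordinate $k$ on $\mathcal{A}$ is $I_k(\mathcal{A})=2\mu(\{x\in\mathcal{A}: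 x\oplus e_k\notin\mathcal{A}\})$, where $x\oplus e_k$ is obtained from $x$ by replacing $x_k$ with $1-x_k$; $I_{\min}(\mathcal{A})=\min_{1\le k\le n}I_k(\mathcal{A})$. -}

module Defs where

open import Data.Bool using (Bool; true; false; not; _∧_)
open import Data.Nat using (ℕ; zero; suc; _^_; _*_)
open import Data.Nat.Properties using (m^n≢0)
open import Data.Fin using (Fin)
open import Data.Vec using (Vec; []; _∷_; lookup; map; updateAt; tabulate; foldr₁)
open import Data.List using (List; []; _∷_; _++_; length; filterᵇ)
import Data.List as List
open import Data.Integer using (+_)
open import Data.Rational using (ℚ; _/_; _-_; _⊓_)
import Data.Rational as ℚ
open import Data.Product using (Σ; ∃; _×_)
open import Relation.Binary.PropositionalEquality using (_≡_)

-- Ω = {0,1}^n : a subset A ⊆ [n] is its indicator vector (true = member).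
Ω : ℕ → Set
Ω n = Vec Bool n

Family : ℕ → Set
Family n = Ω n → Bool

allΩ : (n : ℕ) → List (Ω n)
allΩ zero = [] ∷ []
allΩ (suc n) = List.map (false ∷_) (allΩ n) ++ List.map (true ∷_) (allΩ n)

∣_∣ : ∀ {n} → Family n → ℕ
∣_∣ {n} G = length (filterᵇ G (allΩ n))

_∈ₛ_ : ∀ {n} → Fin n → Ω n → Set
k ∈ₛ A = lookup A k ≡ true

_∈F_ : ∀ {n} → Ω n → Family n → Set
A ∈F G = G A ≡ true

_⊆F_ : ∀ {n} → Family n → Family n → Set
G ⊆F H = ∀ A → A ∈F G → A ∈F H

_∩F_ : ∀ {n} → Family n → Family n → Family n
(G ∩F H) A = G A ∧ H A

_ᶜ : ∀ {n} → Ω n → Ω n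
A ᶜ = map not A

_⊆ₛ_ : ∀ {n} → Ω n → Ω n → Set
B ⊆ₛ A = ∀ k → k ∈ₛ B → k ∈ₛ A

Intersecting : ∀ {n} → Family n → Set
Intersecting {n} G = ∀ A B → A ∈F G → B ∈F G → ∃ λ (k : Fin n) → k ∈ₛ A × k ∈ₛ B

MaximalIntersecting : ∀ {n} → Family n → Set
MaximalIntersecting G =
  Intersecting G × (∀ H → Intersecting H → G ⊆F H → ∀ A → H A ≡ G A)

Increasing : ∀ {n} → Family n → Set
Increasing G = ∀ A B → B ⊆ₛ A → B ∈F G → A ∈F G

Decreasing : ∀ {n} → Family n → Set
Decreasing G = ∀ A B → A ⊆ₛ B → B ∈F G → A ∈F G

Antipodal : ∀ {n} → Family n → Set
Antipodal G = ∀ A → G (A ᶜ) ≡ not (G A)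

star : ∀ {n} → Fin n → Family n
star k A = lookup A k

μ : ∀ {n} → Family n → ℚ
μ {n} G = _/_ (+ ∣ G ∣) (2 ^ n) {{m^n≢0 2 n}}

Cor : ∀ {n} → Family n → Family n → ℚ
Cor A B = μ (A ∩F B) - μ A ℚ.* μ B

flip : ∀ {n} → Ω n → Fin n → Ω n
flip x k = updateAt x k not

I : ∀ {n} → Fin n → Family n → ℚ
I k G = 2ℚ ℚ.* μ (λ x → G x ∧ not (G (flip x k)))
  where 2ℚ = ℚ.1ℚ ℚ.+ ℚ.1ℚ

-- I_min over k ∈ [n], n ≥ 1 (so n = suc m)
Imin : ∀ {m} → Family (suc m) → ℚ
Imin G = foldr₁ _⊓_ (tabulate λ k → I k G)

module Submission where

-- For a decreasing 𝓕 and any coordinate k,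
-- the pairing A ↦ A ⊕ eₖ gives  |𝓕| = 2·|𝓕 ∩ starₖ| + |∂ₖ𝓕|, where ∂ₖ𝓕 is the
-- k-boundary (so Iₖ𝓕 = 2μ(∂ₖ𝓕)); since μ(starₖ) = ½ this turns into the identity
-- Cor(𝓕, starₖ) = -¼·Iₖ(𝓕).  Every antipodal family has measure ½, so on antipodal
-- families Cor(𝓕, 𝓑) is an increasing function of |𝓕 ∩ 𝓑| alone.
--
-- On the combinatorial side: increasing antipodal families are maximal intersecting,
-- maximal intersecting families are antipodal, and every intersecting 𝓑 extends to an
-- increasing antipodal family (its up-closure, completed on each undecided pair
-- {A, Aᶜ} by the member containing the first coordinate).  With these, (a) ⇒ (b) and
-- (c) ⇒ (a) compare |𝓕 ∩ 𝓑| with |𝓕 ∩ starₖ|, and (b) ⇒ (c) uses Iₖ(𝓕) ≥ I_min(𝓕).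

open import Defs
open import Data.Bool using (Bool; true; false; not; _∧_; _∨_)
open import Data.Bool.Properties
  using (not-involutive; ∧-zeroʳ; ∧-identityʳ; ∧-conicalˡ; ∧-conicalʳ; ∨-zeroʳ)
  renaming (_≟_ to _≟ᵇ_)
open import Data.Nat as ℕ using (ℕ; zero; suc; _+_; _^_; _≤_; z≤n; s≤s)
import Data.Nat.Properties as ℕP
open import Data.Nat.Tactic.RingSolver using (solve-∀)
open import Data.Fin using (Fin; zero; suc)
open import Data.Fin.Properties using (any?)
open import Data.Fin.Subset using (_⊆_)
open import Data.Fin.Subset.Properties using (_⊆?_; anySubset?)
open import Data.Vec using ([]; _∷_; lookup; foldr₁; tabulate)
open import Data.Vec.Properties using (lookup-map; []=⇒lookup; lookup⇒[]=)
open import Data.List using (List; []; _∷_; _++_; length; filterᵇ)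
import Data.List as List
open import Data.List.Properties using (length-++; length-map)
open import Data.Integer as ℤ using (ℤ; +_)
import Data.Integer.Properties as ℤP
import Data.Integer.Tactic.RingSolver as ℤSolver
open import Data.Rational using (ℚ; _/_; -_; toℚᵘ; 1ℚ)
import Data.Rational as ℚ
import Data.Rational.Properties as ℚP
open import Data.Rational.Unnormalised as ℚᵘ using (mkℚᵘ; *≡*; *≤*)
import Data.Rational.Unnormalised.Properties as ℚᵘP
open import Data.Rational.Solver using (module +-*-Solver)
open import Data.Product using (Σ; ∃; _×_; _,_; proj₁; proj₂)
open import Data.Sum using (inj₁; inj₂)
open import Data.Empty using (⊥; ⊥-elim)
open import Function.Bundles using (_⇔_; mk⇔)
open import Relation.Nullary using (Dec; yes; no; does)
open import Relation.Nullary.Decidable using (_×-dec_; dec-true)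
import Relation.Nullary.Decidable as Decidable
open import Relation.Binary.PropositionalEquality

count : {A : Set} → (A → Bool) → List A → ℕ
count p xs = length (filterᵇ p xs)

count-++ : {A : Set} (p : A → Bool) (xs ys : List A) →
           count p (xs ++ ys) ≡ count p xs + count p ys
count-++ p [] ys = refl
count-++ p (x ∷ xs) ys with p x
... | true  = cong suc (count-++ p xs ys)
... | false = count-++ p xs ys

count-map : {A B : Set} (p : B → Bool) (f : A → B) (xs : List A) →
            count p (List.map f xs) ≡ count (λ a → p (f a)) xs
count-map p f [] = refl
count-map p f (x ∷ xs) with p (f x)
... | true  = cong suc (count-map p f xs)
... | false = count-map p f xs

count-ext : {A : Set} (p q : A → Bool) → (∀ a → p a ≡ q a) →
            (xs : List A) → count p xs ≡ count q xs
count-ext p q p≗q [] = refl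
count-ext p q p≗q (x ∷ xs) rewrite p≗q x with q x
... | true  = cong suc (count-ext p q p≗q xs)
... | false = count-ext p q p≗q xs

count-mono : {A : Set} (p q : A → Bool) → (∀ a → p a ≡ true → q a ≡ true) →
             (xs : List A) → count p xs ≤ count q xs
count-mono p q p⇒q [] = z≤n
count-mono p q p⇒q (x ∷ xs) with p x in px | q x in qx
... | true  | true  = s≤s (count-mono p q p⇒q xs)
... | true  | false with () ← trans (sym (p⇒q x px)) qx
... | false | true  = ℕP.m≤n⇒m≤1+n (count-mono p q p⇒q xs)
... | false | false = count-mono p q p⇒q xs

count-split : {A : Set} (p q : A → Bool) (xs : List A) →
              count p xs ≡ count (λ a → p a ∧ q a) xs + count (λ a → p a ∧ not (q a)) xs
count-split p q [] = refl
count-split p q (x ∷ xs) with p x | q x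
... | true  | true  = cong suc (count-split p q xs)
... | true  | false = trans (cong suc (count-split p q xs)) (sym (ℕP.+-suc _ _))
... | false | _     = count-split p q xs

count-not : {A : Set} (p : A → Bool) (xs : List A) →
            count p xs + count (λ a → not (p a)) xs ≡ length xs
count-not p [] = refl
count-not p (x ∷ xs) with p x
... | true  = cong suc (count-not p xs)
... | false = trans (ℕP.+-suc _ _) (cong suc (count-not p xs))

count-none : {A : Set} (xs : List A) → count (λ _ → false) xs ≡ 0
count-none [] = refl
count-none (x ∷ xs) = count-none xs

length-allΩ : ∀ n → length (allΩ n) ≡ 2 ^ n
length-allΩ zero = refl
length-allΩ (suc n) = begin
    length (List.map (false ∷_) (allΩ n) ++ List.map (true ∷_) (allΩ n))
  ≡⟨ length-++ (List.map (false ∷_) (allΩ n)) ⟩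
    length (List.map (false ∷_) (allΩ n)) + length (List.map (true ∷_) (allΩ n))
  ≡⟨ cong₂ _+_ (length-map (false ∷_) (allΩ n)) (length-map (true ∷_) (allΩ n)) ⟩
    length (allΩ n) + length (allΩ n)
  ≡⟨ cong₂ _+_ (length-allΩ n) (trans (length-allΩ n) (sym (ℕP.+-identityʳ _))) ⟩
    2 ^ suc n ∎
  where open ≡-Reasoning

section : ∀ {n} → Bool → Family (suc n) → Family n
section b G v = G (b ∷ v)

count-sections : ∀ {n} (G : Family (suc n)) → ∣ G ∣ ≡ ∣ section false G ∣ + ∣ section true G ∣
count-sections {n} G =
  trans (count-++ G (List.map (false ∷_) (allΩ n)) (List.map (true ∷_) (allΩ n)))
        (cong₂ _+_ (count-map G (false ∷_) (allΩ n)) (count-map G (true ∷_) (allΩ n)))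

∣∣-ext : ∀ {n} (G H : Family n) → (∀ A → G A ≡ H A) → ∣ G ∣ ≡ ∣ H ∣
∣∣-ext {n} G H G≗H = count-ext G H G≗H (allΩ n)

∣∣-mono : ∀ {n} (G H : Family n) → G ⊆F H → ∣ G ∣ ≤ ∣ H ∣
∣∣-mono {n} G H G⊆H = count-mono G H G⊆H (allΩ n)

∣∣-empty : ∀ {n} (G : Family n) → (∀ A → G A ≡ false) → ∣ G ∣ ≡ 0
∣∣-empty {n} G G≗∅ = trans (∣∣-ext G (λ _ → false) G≗∅) (count-none (allΩ n))

∣∣-difference : ∀ {n} (G H : Family n) → H ⊆F G →
                ∣ G ∣ ≡ ∣ H ∣ + ∣ (λ A → G A ∧ not (H A)) ∣
∣∣-difference {n} G H H⊆G =
  trans (count-split G H (allΩ n)) (cong (_+ ∣ (λ A → G A ∧ not (H A)) ∣) (∣∣-ext _ H G∧H≗H))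
  where
  G∧H≗H : ∀ A → G A ∧ H A ≡ H A
  G∧H≗H A with H A in hA
  ... | true  = trans (cong (_∧ true) (H⊆G A hA)) refl
  ... | false = ∧-zeroʳ (G A)

∣∣-complement : ∀ {n} (G : Family n) → ∣ G ∣ + ∣ (λ A → not (G A)) ∣ ≡ 2 ^ n
∣∣-complement {n} G = trans (count-not G (allΩ n)) (length-allΩ n)

-- Complementation A ↦ Aᶜ is a bijection of Ω, so it preserves sizes.
∣∣-ᶜ-invariant : ∀ {n} (G : Family n) → ∣ (λ A → G (A ᶜ)) ∣ ≡ ∣ G ∣
∣∣-ᶜ-invariant {zero} G = ∣∣-ext (λ A → G (A ᶜ)) G λ { [] → refl }
∣∣-ᶜ-invariant {suc n} G = begin
    ∣ (λ A → G (A ᶜ)) ∣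
  ≡⟨ count-sections (λ A → G (A ᶜ)) ⟩
    ∣ (λ v → G (true ∷ v ᶜ)) ∣ + ∣ (λ v → G (false ∷ v ᶜ)) ∣
  ≡⟨ cong₂ _+_ (∣∣-ᶜ-invariant (section true G)) (∣∣-ᶜ-invariant (section false G)) ⟩
    ∣ section true G ∣ + ∣ section false G ∣
  ≡⟨ ℕP.+-comm ∣ section true G ∣ ∣ section false G ∣ ⟩
    ∣ section false G ∣ + ∣ section true G ∣
  ≡⟨ count-sections G ⟨
    ∣ G ∣ ∎
  where open ≡-Reasoning

∣∣-antipodal : ∀ {n} (G : Family n) → Antipodal G → ∣ G ∣ + ∣ G ∣ ≡ 2 ^ n
∣∣-antipodal {n} G anti = begin
    ∣ G ∣ + ∣ G ∣
  ≡⟨ cong (λ x → ∣ G ∣ + x) (∣∣-ᶜ-invariant G) ⟨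
    ∣ G ∣ + ∣ (λ A → G (A ᶜ)) ∣
  ≡⟨ cong (λ x → ∣ G ∣ + x) (∣∣-ext (λ A → G (A ᶜ)) (λ A → not (G A)) anti) ⟩
    ∣ G ∣ + ∣ (λ A → not (G A)) ∣
  ≡⟨ ∣∣-complement G ⟩
    2 ^ n ∎
  where open ≡-Reasoning

lookup-ᶜ : ∀ {n} (A : Ω n) k → lookup (A ᶜ) k ≡ not (lookup A k)
lookup-ᶜ A k = lookup-map k not A

ᶜ-involutive : ∀ {n} (A : Ω n) → (A ᶜ) ᶜ ≡ A
ᶜ-involutive [] = refl
ᶜ-involutive (a ∷ A) = cong₂ _∷_ (not-involutive a) (ᶜ-involutive A)

ᶜ-disjoint : ∀ {n} (A : Ω n) k → k ∈ₛ A → k ∈ₛ (A ᶜ) → ⊥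
ᶜ-disjoint A k k∈A k∈Aᶜ with () ← trans (sym k∈Aᶜ) (trans (lookup-ᶜ A k) (cong not k∈A))

ᶜ-antitone : ∀ {n} (A A' : Ω n) → A ⊆ₛ A' → (A' ᶜ) ⊆ₛ (A ᶜ)
ᶜ-antitone A A' A⊆A' k k∈A'ᶜ with lookup A k in k∈A
... | true  = ⊥-elim (ᶜ-disjoint A' k (A⊆A' k k∈A) k∈A'ᶜ)
... | false = trans (lookup-ᶜ A k) (cong not k∈A)

-- Inclusion of sets is decidable; we transport the library's decision procedure
-- for Data.Fin.Subset (which represents subsets by the same Boolean vectors).
⊆⇔⊆ₛ : ∀ {n} {B A : Ω n} → B ⊆ A ⇔ B ⊆ₛ A
⊆⇔⊆ₛ {B = B} {A} = mk⇔
  (λ B⊆A k k∈B → []=⇒lookup (B⊆A (lookup⇒[]= k B k∈B)))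
  (λ B⊆A {k} k∈B → lookup⇒[]= k A (B⊆A k ([]=⇒lookup k∈B)))

_⊆ₛ?_ : ∀ {n} (B A : Ω n) → Dec (B ⊆ₛ A)
B ⊆ₛ? A = Decidable.map ⊆⇔⊆ₛ (B ⊆? A)

does-true⇒ : ∀ {p} {P : Set p} (P? : Dec P) → does P? ≡ true → P
does-true⇒ (yes p) _ = p

upClosure : ∀ {n} → Family n → Family n
upClosure B A = does (anySubset? (λ C → (B C ≟ᵇ true) ×-dec (C ⊆ₛ? A)))

upClosure-witness : ∀ {n} (B : Family n) A →
                    A ∈F upClosure B → ∃ λ C → C ∈F B × C ⊆ₛ A
upClosure-witness B A = does-true⇒ (anySubset? _)

upClosure-intro : ∀ {n} (B : Family n) A C → C ∈F B → C ⊆ₛ A → A ∈F upClosure B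
upClosure-intro B A C C∈B C⊆A = dec-true (anySubset? _) (C , C∈B , C⊆A)

upClosure-⊇ : ∀ {n} (B : Family n) → B ⊆F upClosure B
upClosure-⊇ B A A∈B = upClosure-intro B A A A∈B (λ k k∈A → k∈A)

upClosure-increasing : ∀ {n} (B : Family n) → Increasing (upClosure B)
upClosure-increasing B A A' A'⊆A A'∈U with upClosure-witness B A' A'∈U
... | C , C∈B , C⊆A' = upClosure-intro B A C C∈B (λ k k∈C → A'⊆A k (C⊆A' k k∈C))

upClosure-intersecting : ∀ {n} (B : Family n) → Intersecting B → Intersecting (upClosure B)
upClosure-intersecting B intB A A' A∈U A'∈U
  with upClosure-witness B A A∈U | upClosure-witness B A' A'∈U
... | C , C∈B , C⊆A | C' , C'∈B , C'⊆A' with intB C C' C∈B C'∈B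
...   | k , k∈C , k∈C' = k , C⊆A k k∈C , C'⊆A' k k∈C'

intersecting⇒¬complementary : ∀ {n} (G : Family n) → Intersecting G →
                              ∀ A → A ∈F G → (A ᶜ) ∈F G → ⊥
intersecting⇒¬complementary G intG A A∈G Aᶜ∈G with intG A (A ᶜ) A∈G Aᶜ∈G
... | k , k∈A , k∈Aᶜ = ᶜ-disjoint A k k∈A k∈Aᶜ

_∪F_ : ∀ {n} → Family n → Family n → Family n
(G ∪F H) A = G A ∨ H A

dual : ∀ {n} → Family n → Family n
dual G A = not (G (A ᶜ))

∪F-increasing : ∀ {n} (G H : Family n) → Increasing G → Increasing H → Increasing (G ∪F H)
∪F-increasing G H incG incH A A' A'⊆A A'∈ with G A' in gA'
... | true  rewrite incG A A' A'⊆A gA' = refl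
... | false rewrite incH A A' A'⊆A A'∈ = ∨-zeroʳ (G A)

∩F-increasing : ∀ {n} (G H : Family n) → Increasing G → Increasing H → Increasing (G ∩F H)
∩F-increasing G H incG incH A A' A'⊆A A'∈
  rewrite incG A A' A'⊆A (∧-conicalˡ (G A') (H A') A'∈)
        | incH A A' A'⊆A (∧-conicalʳ (G A') (H A') A'∈) = refl

dual-increasing : ∀ {n} (G : Family n) → Increasing G → Increasing (dual G)
dual-increasing G incG A A' A'⊆A A'∈ with G (A ᶜ) in gAᶜ
... | false = refl
... | true with () ← trans (sym A'∈) (cong not (incG (A' ᶜ) (A ᶜ) (ᶜ-antitone A' A A'⊆A) gAᶜ))

star-increasing : ∀ {n} (k : Fin n) → Increasing (star k)
star-increasing k A A' A'⊆A k∈A' = A'⊆A k k∈A'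

star-antipodal : ∀ {n} (k : Fin n) → Antipodal (star k)
star-antipodal k A = lookup-ᶜ A k

-- Every intersecting family 𝓑 on Ω (suc m) extends to an increasing antipodal one:
-- keep the up-closure 𝓤 of 𝓑, and for each pair {A, Aᶜ} meeting neither 𝓤 nor its
-- complement take the member containing the first coordinate.
extension : ∀ {m} → Family (suc m) → Family (suc m)
extension B = upClosure B ∪F (dual (upClosure B) ∩F star zero)

extension-⊇ : ∀ {m} (B : Family (suc m)) → B ⊆F extension B
extension-⊇ B A A∈B rewrite upClosure-⊇ B A A∈B = refl

extension-increasing : ∀ {m} (B : Family (suc m)) → Increasing (extension B)
extension-increasing B =
  ∪F-increasing U (dual U ∩F star zero) (upClosure-increasing B)
    (∩F-increasing (dual U) (star zero) (dual-increasing U (upClosure-increasing B))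
                   (star-increasing zero))
  where U = upClosure B

extension-antipodal : ∀ {m} (B : Family (suc m)) → Intersecting B → Antipodal (extension B)
extension-antipodal B intB A = begin
    U (A ᶜ) ∨ (not (U ((A ᶜ) ᶜ)) ∧ lookup (A ᶜ) zero)
  ≡⟨ cong₂ (λ X b → U (A ᶜ) ∨ (not (U X) ∧ b)) (ᶜ-involutive A) (lookup-ᶜ A zero) ⟩
    U (A ᶜ) ∨ (not (U A) ∧ not (lookup A zero))
  ≡⟨ flip-pair (U A) (U (A ᶜ)) (lookup A zero)
       (intersecting⇒¬complementary U (upClosure-intersecting B intB) A) ⟩
    not (U A ∨ (not (U (A ᶜ)) ∧ lookup A zero)) ∎
  where
  open ≡-Reasoning
  U = upClosure B
  -- u, u' are the memberships of A, Aᶜ in 𝓤 (never both true), z that of 0 in A.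
  flip-pair : ∀ u u' z → (u ≡ true → u' ≡ true → ⊥) →
              u' ∨ (not u ∧ not z) ≡ not (u ∨ (not u' ∧ z))
  flip-pair true  true  z ¬both = ⊥-elim (¬both refl refl)
  flip-pair true  false z ¬both = refl
  flip-pair false true  z ¬both = refl
  flip-pair false false z ¬both = refl

-- An increasing antipodal family is intersecting: two disjoint members A, C would
-- give C ⊆ Aᶜ, hence Aᶜ in the family together with A.
increasing-antipodal⇒intersecting : ∀ {n} (G : Family n) → Increasing G → Antipodal G →
                                    Intersecting G
increasing-antipodal⇒intersecting G inc anti A C A∈G C∈G
  with any? (λ k → (lookup A k ≟ᵇ true) ×-dec (lookup C k ≟ᵇ true))
... | yes common = common
... | no ¬common = ⊥-elim (t≢f (trans (sym Aᶜ∈G) (trans (anti A) (cong not A∈G))))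
  where
  t≢f : true ≡ false → ⊥
  t≢f ()
  C⊆Aᶜ : C ⊆ₛ (A ᶜ)
  C⊆Aᶜ k k∈C with lookup A k in k∈A
  ... | true  = ⊥-elim (¬common (k , k∈A , k∈C))
  ... | false = trans (lookup-ᶜ A k) (cong not k∈A)
  Aᶜ∈G : (A ᶜ) ∈F G
  Aᶜ∈G = inc (A ᶜ) C C⊆Aᶜ C∈G

-- ... and maximal: any intersecting 𝓗 ⊇ 𝓖 cannot contain a set whose complement lies in 𝓖.
increasing-antipodal⇒maximal : ∀ {n} (G : Family n) → Increasing G → Antipodal G →
                               MaximalIntersecting G
increasing-antipodal⇒maximal G inc anti = increasing-antipodal⇒intersecting G inc anti , maximal
  where
  maximal : ∀ H → Intersecting H → G ⊆F H → ∀ A → H A ≡ G A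
  maximal H intH G⊆H A with G A in gA
  ... | true = G⊆H A gA
  ... | false with H A in hA
  ...   | false = refl
  ...   | true = ⊥-elim (intersecting⇒¬complementary H intH A hA
                           (G⊆H (A ᶜ) (trans (anti A) (cong not gA))))

-- A maximal intersecting family equals its (intersecting) extension, hence is antipodal.
maximal⇒antipodal : ∀ {m} (B : Family (suc m)) → MaximalIntersecting B → Antipodal B
maximal⇒antipodal B (intB , maxB) A = begin
    B (A ᶜ)                ≡⟨ B≗E (A ᶜ) ⟨
    extension B (A ᶜ)      ≡⟨ extension-antipodal B intB A ⟩
    not (extension B A)    ≡⟨ cong not (B≗E A) ⟩
    not (B A)              ∎
  where
  open ≡-Reasoning
  E = extension B
  B≗E : ∀ A → E A ≡ B A
  B≗E = maxB E (increasing-antipodal⇒intersecting E (extension-increasing B)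
                  (extension-antipodal B intB))
                (extension-⊇ B)

boundary : ∀ {n} → Fin n → Family n → Family n
boundary k F x = F x ∧ not (F (flip x k))

section-decreasing : ∀ {n} (F : Family (suc n)) b → Decreasing F → Decreasing (section b F)
section-decreasing F b dec A A' A⊆A' A'∈F = dec (b ∷ A) (b ∷ A') bA⊆bA' A'∈F
  where
  bA⊆bA' : (b ∷ A) ⊆ₛ (b ∷ A')
  bA⊆bA' zero    k∈ = k∈
  bA⊆bA' (suc k) k∈ = A⊆A' k k∈

upper⊆lower : ∀ {n} (F : Family (suc n)) → Decreasing F → section true F ⊆F section false F
upper⊆lower F dec v = dec (false ∷ v) (true ∷ v) 0∷v⊆1∷v
  where
  0∷v⊆1∷v : (false ∷ v) ⊆ₛ (true ∷ v)
  0∷v⊆1∷v zero    ()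
  0∷v⊆1∷v (suc k) k∈ = k∈

-- Along the first coordinate, 𝓕 ∩ star₀ is the upper section, ∂₀𝓕 is the lower section
-- minus the upper one, and the upper section is contained in the lower one; other
-- coordinates reduce to the two sections.
boundary-decomposition : ∀ {n} (k : Fin n) (F : Family n) → Decreasing F →
  ∣ F ∣ ≡ ∣ F ∩F star k ∣ + ∣ F ∩F star k ∣ + ∣ boundary k F ∣
boundary-decomposition {suc n} zero F dec = begin
    ∣ F ∣
  ≡⟨ count-sections F ⟩
    ∣ F₀ ∣ + ∣ F₁ ∣
  ≡⟨ cong (_+ ∣ F₁ ∣) (∣∣-difference F₀ F₁ (upper⊆lower F dec)) ⟩
    (∣ F₁ ∣ + ∣ F₀∖F₁ ∣) + ∣ F₁ ∣
  ≡⟨ rearrange ∣ F₁ ∣ ∣ F₀∖F₁ ∣ ⟩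
    (0 + ∣ F₁ ∣) + (0 + ∣ F₁ ∣) + (∣ F₀∖F₁ ∣ + 0)
  ≡⟨ cong₂ (λ s b → s + s + b) star₀-sections boundary₀-sections ⟨
    ∣ F ∩F star zero ∣ + ∣ F ∩F star zero ∣ + ∣ boundary zero F ∣ ∎
  where
  open ≡-Reasoning
  F₀ F₁ F₀∖F₁ : Family n
  F₀ = section false F
  F₁ = section true F
  F₀∖F₁ v = F₀ v ∧ not (F₁ v)
  rearrange : ∀ a x → (a + x) + a ≡ (0 + a) + (0 + a) + (x + 0)
  rearrange = solve-∀
  star₀-sections : ∣ F ∩F star zero ∣ ≡ 0 + ∣ F₁ ∣
  star₀-sections = trans (count-sections (F ∩F star zero))
    (cong₂ _+_ (∣∣-empty _ (λ v → ∧-zeroʳ (F₀ v))) (∣∣-ext _ F₁ (λ v → ∧-identityʳ (F₁ v))))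
  F₁∖F₀-empty : ∀ v → F₁ v ∧ not (F₀ v) ≡ false
  F₁∖F₀-empty v with F₁ v in f₁
  ... | false = refl
  ... | true rewrite upper⊆lower F dec v f₁ = refl
  boundary₀-sections : ∣ boundary zero F ∣ ≡ ∣ F₀∖F₁ ∣ + 0
  boundary₀-sections = trans (count-sections (boundary zero F))
    (cong (λ x → ∣ F₀∖F₁ ∣ + x) (∣∣-empty _ F₁∖F₀-empty))
boundary-decomposition {suc n} (suc k) F dec = begin
    ∣ F ∣
  ≡⟨ count-sections F ⟩
    ∣ F₀ ∣ + ∣ F₁ ∣
  ≡⟨ cong₂ _+_ (boundary-decomposition k F₀ (section-decreasing F false dec))
               (boundary-decomposition k F₁ (section-decreasing F true dec)) ⟩
    (s₀ + s₀ + b₀) + (s₁ + s₁ + b₁)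
  ≡⟨ interchange s₀ b₀ s₁ b₁ ⟩
    (s₀ + s₁) + (s₀ + s₁) + (b₀ + b₁)
  ≡⟨ cong₂ (λ s b → s + s + b) (count-sections (F ∩F star (suc k)))
                               (count-sections (boundary (suc k) F)) ⟨
    ∣ F ∩F star (suc k) ∣ + ∣ F ∩F star (suc k) ∣ + ∣ boundary (suc k) F ∣ ∎
  where
  open ≡-Reasoning
  F₀ F₁ : Family n
  F₀ = section false F
  F₁ = section true F
  s₀ = ∣ F₀ ∩F star k ∣
  s₁ = ∣ F₁ ∩F star k ∣
  b₀ = ∣ boundary k F₀ ∣
  b₁ = ∣ boundary k F₁ ∣
  interchange : ∀ s₀ b₀ s₁ b₁ → (s₀ + s₀ + b₀) + (s₁ + s₁ + b₁) ≡ (s₀ + s₁) + (s₀ + s₁) + (b₀ + b₁)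
  interchange = solve-∀

-- The rational a / (d+1): the measure of an a-element family in a cube of d+1 points.
ν : ℕ → ℕ → ℚ
ν d a = + a / suc d

-- Computations with ν go through unnormalised rationals, where a/(d+1) is literal.
toℚᵘ-ν : ∀ d a → toℚᵘ (ν d a) ℚᵘ.≃ mkℚᵘ (+ a) d
toℚᵘ-ν d a = ℚP.toℚᵘ-fromℚᵘ (mkℚᵘ (+ a) d)

ν-+ : ∀ d a b → ν d (a + b) ≡ ν d a ℚ.+ ν d b
ν-+ d a b = ℚP.toℚᵘ-injective (begin
    toℚᵘ (ν d (a + b))                  ≈⟨ toℚᵘ-ν d (a + b) ⟩
    mkℚᵘ (+ (a + b)) d                  ≈⟨ *≡* cross-multiplied ⟩
    mkℚᵘ (+ a) d ℚᵘ.+ mkℚᵘ (+ b) d      ≈⟨ ℚᵘP.+-cong (toℚᵘ-ν d a) (toℚᵘ-ν d b) ⟨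
    toℚᵘ (ν d a) ℚᵘ.+ toℚᵘ (ν d b)      ≈⟨ ℚP.toℚᵘ-homo-+ (ν d a) (ν d b) ⟨
    toℚᵘ (ν d a ℚ.+ ν d b)              ∎)
  where
  open ℚᵘP.≃-Reasoning
  distrib : ∀ (x y z : ℤ) → (x ℤ.+ y) ℤ.* (z ℤ.* z) ≡ (x ℤ.* z ℤ.+ y ℤ.* z) ℤ.* z
  distrib = ℤSolver.solve-∀
  cross-multiplied : + (a + b) ℤ.* + (suc d ℕ.* suc d) ≡ (+ a ℤ.* + suc d ℤ.+ + b ℤ.* + suc d) ℤ.* + suc d
  cross-multiplied rewrite ℤP.pos-+ a b | ℤP.pos-* (suc d) (suc d) = distrib (+ a) (+ b) (+ suc d)

ν-mono : ∀ d a b → a ≤ b → ν d a ℚ.≤ ν d b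
ν-mono d a b a≤b = ℚP.toℚᵘ-cancel-≤
  (ℚᵘP.≤-respˡ-≃ (ℚᵘP.≃-sym (toℚᵘ-ν d a)) (ℚᵘP.≤-respʳ-≃ (ℚᵘP.≃-sym (toℚᵘ-ν d b))
    (*≤* (ℤP.*-monoʳ-≤-nonNeg (+ suc d) (ℤ.+≤+ a≤b)))))

ν-cancel-≤ : ∀ d a b → ν d a ℚ.≤ ν d b → a ≤ b
ν-cancel-≤ d a b νa≤νb
  with ℚᵘP.≤-respˡ-≃ (toℚᵘ-ν d a) (ℚᵘP.≤-respʳ-≃ (toℚᵘ-ν d b) (ℚP.toℚᵘ-mono-≤ νa≤νb))
... | *≤* cross with ℤP.*-cancelʳ-≤-pos (+ a) (+ b) (+ suc d) cross
...   | ℤ.+≤+ a≤b = a≤b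

ν-half : ∀ d a → a + a ≡ suc d → ν d a ≡ + 1 / 2
ν-half d a a+a≡d+1 = ℚP.toℚᵘ-injective (ℚᵘP.≃-trans (toℚᵘ-ν d a) (*≡* cross-multiplied))
  where
  cross-multiplied : + a ℤ.* + 2 ≡ + 1 ℤ.* + suc d
  cross-multiplied = begin
      + a ℤ.* + 2     ≡⟨ ℤP.pos-* a 2 ⟨
      + (a ℕ.* 2)     ≡⟨ cong +_ (trans (ℕP.*-comm a 2) (cong (λ x → a + x) (ℕP.+-identityʳ a))) ⟩
      + (a + a)       ≡⟨ cong +_ a+a≡d+1 ⟩
      + suc d         ≡⟨ ℤP.*-identityˡ (+ suc d) ⟨
      + 1 ℤ.* + suc d ∎
    where open ≡-Reasoning

-- The two constants of the theorem, and the identity behind Cor(𝓕, starₖ) = -¼·Iₖ(𝓕):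
-- with c = μ(𝓕 ∩ starₖ) and b = μ(∂ₖ𝓕) we have μ(𝓕) = 2c + b.
½ ¼ : ℚ
½ = + 1 / 2
¼ = + 1 / 4

star-correlation-identity : ∀ c b → c ℚ.- (c ℚ.+ c ℚ.+ b) ℚ.* ½ ≡ (- ¼) ℚ.* ((1ℚ ℚ.+ 1ℚ) ℚ.* b)
star-correlation-identity c b = begin
    c ℚ.- (c ℚ.+ c ℚ.+ b) ℚ.* ½
  ≡⟨ solve 3 (λ c b h → c :- (c :+ c :+ b) :* h := c :* (con 1ℚ :- (h :+ h)) :- h :* b) refl c b ½ ⟩
    c ℚ.* (1ℚ ℚ.- (½ ℚ.+ ½)) ℚ.- ½ ℚ.* b
  ≡⟨⟩
    c ℚ.* (1ℚ ℚ.- 1ℚ) ℚ.- ½ ℚ.* b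
  ≡⟨ solve 3 (λ c b h → c :* (con 1ℚ :- con 1ℚ) :- h :* b := :- (h :* b)) refl c b ½ ⟩
    - (½ ℚ.* b)
  ≡⟨⟩
    - ((¼ ℚ.* (1ℚ ℚ.+ 1ℚ)) ℚ.* b)
  ≡⟨ solve 2 (λ q b → :- ((q :* (con 1ℚ :+ con 1ℚ)) :* b) := (:- q) :* ((con 1ℚ :+ con 1ℚ) :* b)) refl ¼ b ⟩
    (- ¼) ℚ.* ((1ℚ ℚ.+ 1ℚ) ℚ.* b) ∎
  where
  open ≡-Reasoning
  open +-*-Solver

subtract-cancel-≤ : ∀ x y z → x ℚ.- z ℚ.≤ y ℚ.- z → x ℚ.≤ y
subtract-cancel-≤ x y z x-z≤y-z = subst₂ ℚ._≤_ (add-back x) (add-back y) (ℚP.+-monoˡ-≤ z x-z≤y-z)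
  where
  add-back : ∀ w → w ℚ.- z ℚ.+ z ≡ w
  add-back w = trans (ℚP.+-assoc w (- z) z)
                     (trans (cong (w ℚ.+_) (ℚP.+-inverseˡ z)) (ℚP.+-identityʳ w))

module Correlation (n : ℕ) where

  private
    d : ℕ
    d = ℕ.pred (2 ^ n)

    2ⁿ≡d+1 : 2 ^ n ≡ suc d
    2ⁿ≡d+1 = sym (ℕP.suc-pred (2 ^ n) {{ℕP.m^n≢0 2 n}})

  μ≡ν : (G : Family n) → μ G ≡ ν d ∣ G ∣
  μ≡ν G = ℚP./-cong {p₁ = + ∣ G ∣} {p₂ = + ∣ G ∣} {{ℕP.m^n≢0 2 n}} refl 2ⁿ≡d+1

  μ-antipodal : (G : Family n) → Antipodal G → μ G ≡ ½
  μ-antipodal G anti = trans (μ≡ν G) (ν-half d ∣ G ∣ (trans (∣∣-antipodal G anti) 2ⁿ≡d+1))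

  Cor-star : (F : Family n) → Decreasing F → ∀ k → Cor F (star k) ≡ (- ¼) ℚ.* I k F
  Cor-star F dec k = begin
      μ (F ∩F star k) ℚ.- μ F ℚ.* μ (star k)
    ≡⟨ cong₂ (λ x y → x ℚ.- y) (μ≡ν (F ∩F star k))
             (cong₂ ℚ._*_ μF≡2c+b (μ-antipodal (star k) (star-antipodal k))) ⟩
      c ℚ.- (c ℚ.+ c ℚ.+ b) ℚ.* ½
    ≡⟨ star-correlation-identity c b ⟩
      (- ¼) ℚ.* ((1ℚ ℚ.+ 1ℚ) ℚ.* b)
    ≡⟨ cong (λ x → (- ¼) ℚ.* ((1ℚ ℚ.+ 1ℚ) ℚ.* x)) (μ≡ν (boundary k F)) ⟨
      (- ¼) ℚ.* I k F ∎
    where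
    open ≡-Reasoning
    c = ν d ∣ F ∩F star k ∣
    b = ν d ∣ boundary k F ∣
    μF≡2c+b : μ F ≡ c ℚ.+ c ℚ.+ b
    μF≡2c+b = begin
        μ F
      ≡⟨ μ≡ν F ⟩
        ν d ∣ F ∣
      ≡⟨ cong (ν d) (boundary-decomposition k F dec) ⟩
        ν d (∣ F ∩F star k ∣ + ∣ F ∩F star k ∣ + ∣ boundary k F ∣)
      ≡⟨ ν-+ d (∣ F ∩F star k ∣ + ∣ F ∩F star k ∣) ∣ boundary k F ∣ ⟩
        ν d (∣ F ∩F star k ∣ + ∣ F ∩F star k ∣) ℚ.+ b
      ≡⟨ cong (ℚ._+ b) (ν-+ d ∣ F ∩F star k ∣ ∣ F ∩F star k ∣) ⟩
        c ℚ.+ c ℚ.+ b ∎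

  Cor-antipodal : (F B : Family n) → Antipodal B → Cor F B ≡ ν d ∣ F ∩F B ∣ ℚ.- μ F ℚ.* ½
  Cor-antipodal F B anti = cong₂ (λ x y → x ℚ.- μ F ℚ.* y) (μ≡ν (F ∩F B)) (μ-antipodal B anti)

  Cor-mono : (F B B' : Family n) → Antipodal B → Antipodal B' →
             ∣ F ∩F B ∣ ≤ ∣ F ∩F B' ∣ → Cor F B ℚ.≤ Cor F B'
  Cor-mono F B B' anti anti' ∣F∩B∣≤∣F∩B'∣ =
    subst₂ ℚ._≤_ (sym (Cor-antipodal F B anti)) (sym (Cor-antipodal F B' anti'))
      (ℚP.+-monoˡ-≤ (- (μ F ℚ.* ½)) (ν-mono d ∣ F ∩F B ∣ ∣ F ∩F B' ∣ ∣F∩B∣≤∣F∩B'∣))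

  Cor-reflect : (F B B' : Family n) → Antipodal B → Antipodal B' →
                Cor F B ℚ.≤ Cor F B' → ∣ F ∩F B ∣ ≤ ∣ F ∩F B' ∣
  Cor-reflect F B B' anti anti' Cor≤Cor =
    ν-cancel-≤ d ∣ F ∩F B ∣ ∣ F ∩F B' ∣
      (subtract-cancel-≤ (ν d ∣ F ∩F B ∣) (ν d ∣ F ∩F B' ∣) (μ F ℚ.* ½)
        (subst₂ ℚ._≤_ (Cor-antipodal F B anti) (Cor-antipodal F B' anti') Cor≤Cor))

min≤ : ∀ {m} (f : Fin (suc m) → ℚ) k → foldr₁ ℚ._⊓_ (tabulate f) ℚ.≤ f k
min≤ {zero}  f zero    = ℚP.≤-refl
min≤ {suc m} f zero    = ℚP.p⊓q≤p (f zero) _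
min≤ {suc m} f (suc k) = ℚP.≤-trans (ℚP.p⊓q≤q (f zero) _) (min≤ (λ i → f (suc i)) k)

min-attained : ∀ {m} (f : Fin (suc m) → ℚ) → ∃ λ k → foldr₁ ℚ._⊓_ (tabulate f) ≡ f k
min-attained {zero} f = zero , refl
min-attained {suc m} f with ℚP.⊓-sel (f zero) (foldr₁ ℚ._⊓_ (tabulate (λ i → f (suc i))))
... | inj₁ min≡f0   = zero , min≡f0
... | inj₂ min≡rest with min-attained (λ i → f (suc i))
...   | k , rest≡fk = suc k , trans min≡rest rest≡fk

∩F-⊆ˡ : ∀ {n} (F B : Family n) → (F ∩F B) ⊆F F
∩F-⊆ˡ F B A A∈F∩B = ∧-conicalˡ (F A) (B A) A∈F∩B

∩F-greatest : ∀ {n} (B F E : Family n) → B ⊆F F → B ⊆F E → B ⊆F (F ∩F E)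
∩F-greatest B F E B⊆F B⊆E A A∈B rewrite B⊆F A A∈B | B⊆E A A∈B = refl

∩F-intersecting : ∀ {n} (F B : Family n) → Intersecting B → Intersecting (F ∩F B)
∩F-intersecting F B intB A C A∈F∩B C∈F∩B =
  intB A C (∧-conicalʳ (F A) (B A) A∈F∩B) (∧-conicalʳ (F C) (B C) C∈F∩B)

star-maximal : ∀ {n} (k : Fin n) → MaximalIntersecting (star k)
star-maximal k = increasing-antipodal⇒maximal (star k) (star-increasing k) (star-antipodal k)

LargestIntersectingStar : ∀ {m} → Family (suc m) → Fin (suc m) → Set
LargestIntersectingStar {m} F k =
  (∀ (B : Family (suc m)) → B ⊆F F → Intersecting B → ∣ B ∣ ≤ ∣ F ∩F star k ∣)
  × (Σ (Family (suc m)) λ B → B ⊆F F × Intersecting B × ∣ B ∣ ≡ ∣ F ∩F star k ∣)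

StarMaximisesCor : ∀ {m} → Family (suc m) → Fin (suc m) → Set
StarMaximisesCor {m} F k =
  MaximalIntersecting (star k)
  × (∀ (B : Family (suc m)) → MaximalIntersecting B → Cor F B ℚ.≤ Cor F (star k))

CorBoundedByInfluence : ∀ {m} → Family (suc m) → Set
CorBoundedByInfluence {m} F =
  ∀ (B : Family (suc m)) → Increasing B → Antipodal B → Cor F B ℚ.≤ (- ¼) ℚ.* Imin F

-- (a) ⇒ (b): maximal intersecting families are antipodal, so Cor(𝓕, 𝓑) is governed by
-- |𝓕 ∩ 𝓑|, which (a) bounds by |𝓕 ∩ starₖ|.
a⇒b : ∀ {m} (F : Family (suc m)) →
      (∃ λ k → LargestIntersectingStar F k) → ∃ λ k → StarMaximisesCor F k
a⇒b {m} F (k , largest , _) = k , star-maximal k , λ B maxB →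
  Cor-mono F B (star k) (maximal⇒antipodal B maxB) (star-antipodal k)
    (largest (F ∩F B) (∩F-⊆ˡ F B) (∩F-intersecting F B (proj₁ maxB)))
  where open Correlation (suc m)

-- (b) ⇒ (c): increasing antipodal families are maximal intersecting, so their correlation
-- is at most Cor(𝓕, starₖ) = -¼·Iₖ(𝓕) ≤ -¼·I_min(𝓕).
b⇒c : ∀ {m} (F : Family (suc m)) → Decreasing F →
      (∃ λ k → StarMaximisesCor F k) → CorBoundedByInfluence F
b⇒c {m} F dec (k , _ , starMaximises) B inc anti = begin
    Cor F B           ≤⟨ starMaximises B (increasing-antipodal⇒maximal B inc anti) ⟩
    Cor F (star k)    ≡⟨ Cor-star F dec k ⟩
    (- ¼) ℚ.* I k F   ≤⟨ ℚP.*-monoˡ-≤-nonPos (- ¼) (min≤ (λ i → I i F) k) ⟩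
    (- ¼) ℚ.* Imin F  ∎
  where
  open Correlation (suc m)
  open ℚP.≤-Reasoning

-- (c) ⇒ (a): take k with Iₖ(𝓕) = I_min(𝓕).  An intersecting 𝓑 ⊆ 𝓕 lies in its increasing
-- antipodal extension 𝓔, and (c) gives Cor(𝓕, 𝓔) ≤ Cor(𝓕, starₖ), i.e. |𝓕 ∩ 𝓔| ≤ |𝓕 ∩ starₖ|.
c⇒a : ∀ {m} (F : Family (suc m)) → Decreasing F →
      CorBoundedByInfluence F → ∃ λ k → LargestIntersectingStar F k
c⇒a {m} F dec bounded = k , largest , (F ∩F star k , ∩F-⊆ˡ F (star k) , F∩starₖ-intersecting , refl)
  where
  open Correlation (suc m)
  k : Fin (suc m)
  k = proj₁ (min-attained (λ i → I i F))
  Imin≡Iₖ : Imin F ≡ I k F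
  Imin≡Iₖ = proj₂ (min-attained (λ i → I i F))
  F∩starₖ-intersecting : Intersecting (F ∩F star k)
  F∩starₖ-intersecting = ∩F-intersecting F (star k) (proj₁ (star-maximal k))
  largest : ∀ B → B ⊆F F → Intersecting B → ∣ B ∣ ≤ ∣ F ∩F star k ∣
  largest B B⊆F intB = ℕP.≤-trans
      (∣∣-mono B (F ∩F E) (∩F-greatest B F E B⊆F (extension-⊇ B)))
      (Cor-reflect F E (star k) antiE (star-antipodal k) Cor-E≤Cor-starₖ)
    where
    E = extension B
    antiE = extension-antipodal B intB
    Cor-E≤Cor-starₖ : Cor F E ℚ.≤ Cor F (star k)
    Cor-E≤Cor-starₖ = begin
      Cor F E           ≤⟨ bounded E (extension-increasing B) antiE ⟩
      (- ¼) ℚ.* Imin F  ≡⟨ cong ((- ¼) ℚ.*_) Imin≡Iₖ ⟩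
      (- ¼) ℚ.* I k F   ≡⟨ Cor-star F dec k ⟨
      Cor F (star k)    ∎
      where open ℚP.≤-Reasoning

proposition2p1 : (m : ℕ) → (F : Family (suc m)) → Decreasing F →
    let
      n = suc m
      a = ∃ λ (k : Fin n) →
            (∀ (B : Family n) → B ⊆F F → Intersecting B → ∣ B ∣ ≤ ∣ F ∩F star k ∣)
            × (Σ (Family n) λ B → B ⊆F F × Intersecting B × ∣ B ∣ ≡ ∣ F ∩F star k ∣)
      b = ∃ λ (k : Fin n) →
            MaximalIntersecting (star k)
            × (∀ (B : Family n) → MaximalIntersecting B → Cor F B ℚ.≤ Cor F (star k))
      c = ∀ (B : Family n) → Increasing B → Antipodal B →
            Cor F B ℚ.≤ (- ((+ 1) / 4)) ℚ.* Imin F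
    in (a → b) × (b → c) × (c → a)
proposition2p1 m F dec = a⇒b F , b⇒c F dec , c⇒a F dec
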